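{- Let $\mathbb{V}=U\oplus W$ be an $n$-dimensional vector space ($n\ge 2$) over a finite field $\mathcal{F}$ with $q$ elements, where $U$ and $W$ are nonzero subspaces. Then the edge connectivity of the direct sum graph $\Gamma_{U\oplus W}(\mathbb{V})$ is $(q-1)^2q^{n-2}-1$.
   Context: Let $\dim U=r$, $\dim W=s$, $r+s=n$. Fix a basis $\{\alpha_1,\dots,\alpha_r\}$ of $U$ and a basis $\{\beta_1,\dots,\beta_s\}$ of $W$; every $x\in\mathbb{V}$ is written uniquely as $x=\sum_i a_i\alpha_i+\sum_j b_j\beta_j$. The direct sum graph $\Gamma_{U\oplus W}(\mathbb{V})$ is the simple graph whose vertex set is $\{x=u+w: u\in U, w\in W, u\neq 0, w\neq 0\}$, in which two distinct vertices $x,y$ are adjacent iff there is an index $i$ such that the coefficient of $\alpha_i$ is nonzero in both $x$ and $y$, and there is an index $j$ such that the coefficient of $\beta_j$ is nonzero in both $x$ and $y$. The edge connectivity is the minimum number of edges whose removal disconnects the graph. -}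

module Defs where

open import Level using (Level; _⊔_)
open import Data.Nat using (ℕ; suc; _<_)
open import Data.Fin using (Fin)
open import Data.List using (List; length)
open import Data.List.Membership.Propositional using (_∈_)
open import Data.Product using (Σ; ∃; ∃-syntax; _×_; _,_; proj₁; proj₂)
open import Data.Sum using (_⊎_)
open import Relation.Nullary using (¬_)
open import Relation.Binary.PropositionalEquality using (_≡_)
open import Relation.Binary.Construct.Closure.ReflexiveTransitive using (Star)
open import Algebra.Bundles using (CommutativeRing)

record IsField {c ℓ : Level} (R : CommutativeRing c ℓ) : Set (c ⊔ ℓ) where
  open CommutativeRing R
  field
    0≉1     : ¬ (0# ≈ 1#)
    inverse : ∀ x → ¬ (x ≈ 0#) → ∃[ y ] (x * y ≈ 1#)

record HasCard {c ℓ : Level} (R : CommutativeRing c ℓ) (q : ℕ) : Set (c ⊔ ℓ) where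
  open CommutativeRing R
  field
    enum      : Fin q → Carrier
    surj      : ∀ x → ∃[ i ] (enum i ≈ x)
    injective : ∀ i j → enum i ≈ enum j → i ≡ j

record Graph (v e : Level) : Set (Level.suc (v ⊔ e)) where
  field
    Vertex : Set v
    _≈V_   : Vertex → Vertex → Set e
    Adj    : Vertex → Vertex → Set e

module _ {v e : Level} (G : Graph v e) where
  open Graph G

  EdgeIn : List (Vertex × Vertex) → Vertex → Vertex → Set (v ⊔ e)
  EdgeIn F x y = ∃[ p ] (p ∈ F × ((proj₁ p ≈V x × proj₂ p ≈V y) ⊎ (proj₁ p ≈V y × proj₂ p ≈V x)))

  AdjMinus : List (Vertex × Vertex) → Vertex → Vertex → Set (v ⊔ e)
  AdjMinus F x y = Adj x y × ¬ EdgeIn F x y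

  ConnectedMinus : List (Vertex × Vertex) → Set (v ⊔ e)
  ConnectedMinus F = ∀ x y → ∃[ z ] (Star (AdjMinus F) x z × z ≈V y)

  -- Diestel: G is ℓ-edge-connected if |G| > 1 and G − F is connected
  -- for every set F of fewer than ℓ edges.  (Lists may contain repetitions
  -- or non-edges; this does not change the notion.)
  EdgeConnected : ℕ → Set (v ⊔ e)
  EdgeConnected k =
    (∃[ x ] ∃[ y ] ¬ (x ≈V y)) × (∀ (F : List (Vertex × Vertex)) → length F < k → ConnectedMinus F)

  -- λ(G) = k : the greatest k such that G is k-edge-connected
  -- (with λ = 0 when G is not even 0-edge-connected, i.e. |G| ≤ 1).
  -- Equivalently, for nontrivial G, the minimum number of edges whose
  -- removal disconnects G.
  IsEdgeConnectivity : ℕ → Set (v ⊔ e)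
  IsEdgeConnectivity k = (EdgeConnected k ⊎ k ≡ 0) × ¬ EdgeConnected (suc k)

-- The direct sum graph Γ_{U⊕W}(V), in coordinates w.r.t. a basis
-- α₁..α_r of U and β₁..β_s of W: a vector x = Σ aᵢαᵢ + Σ bⱼβⱼ is the
-- pair (a , b).

module _ {c ℓ : Level} (R : CommutativeRing c ℓ) where
  open CommutativeRing R

  DSVertex : ℕ → ℕ → Set (c ⊔ ℓ)
  DSVertex r s = Σ ((Fin r → Carrier) × (Fin s → Carrier)) λ ab →
    ¬ (∀ i → proj₁ ab i ≈ 0#) × ¬ (∀ j → proj₂ ab j ≈ 0#)

  coefU : ∀ {r s} → DSVertex r s → Fin r → Carrier
  coefU x = proj₁ (proj₁ x)

  coefW : ∀ {r s} → DSVertex r s → Fin s → Carrier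
  coefW x = proj₂ (proj₁ x)

  _≈DS_ : ∀ {r s} → DSVertex r s → DSVertex r s → Set ℓ
  x ≈DS y = (∀ i → coefU x i ≈ coefU y i) × (∀ j → coefW x j ≈ coefW y j)

  DSAdj : ∀ {r s} → DSVertex r s → DSVertex r s → Set ℓ
  DSAdj x y = ¬ (x ≈DS y)
    × (∃[ i ] (¬ (coefU x i ≈ 0#) × ¬ (coefU y i ≈ 0#)))
    × (∃[ j ] (¬ (coefW x j ≈ 0#) × ¬ (coefW y j ≈ 0#)))

  DirectSumGraph : ℕ → ℕ → Graph (c ⊔ ℓ) ℓ
  DirectSumGraph r s = record { Vertex = DSVertex r s ; _≈V_ = _≈DS_ ; Adj = DSAdj }

-- For coordinate positions i and j, the vectors whose αᵢ- and βⱼ-coefficients are both nonzero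
-- form a clique of size N = (q-1)² q^(n-2), and these cliques cover the graph and pairwise meet
-- (in the all-ones vector).  Deleting at most N - 2 edges from a clique of size N leaves any two
-- of its vertices joined directly or through a third vertex, by pigeonhole on the deleted edges,
-- so the graph stays connected.  Conversely α₁ + β₁ is adjacent exactly to the other N - 1
-- members of its clique, and deleting those edges isolates it.

module Submission where

open import Defs
open import Level using (Level; _⊔_) renaming (suc to lsuc)
open import Function using (_∘_; _on_)
open import Data.Nat using (ℕ; zero; suc; _+_; _*_; _∸_; _^_; _≤_; _<_; s≤s; z≤n)
import Data.Nat.Properties as ℕ
open import Data.Fin using (Fin; zero; suc; punchIn; punchOut; remQuot; combine; inject₁; fromℕ)
import Data.Fin.Properties as Fin
open import Data.Product using (Σ; ∃; ∃-syntax; _×_; _,_; proj₁; proj₂)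
open import Data.Product.Relation.Binary.Pointwise.NonDependent using (Pointwise; ×-isDecEquivalence)
open import Data.Sum using (_⊎_; inj₁; inj₂)
open import Data.Unit using (⊤; tt)
open import Data.Empty using (⊥-elim)
open import Data.List using (List; length; lookup; tabulate)
open import Data.List.Properties using (length-tabulate)
open import Data.List.Relation.Unary.Any using (index; any?)
open import Data.List.Relation.Unary.Any.Properties using (lookup-index)
open import Data.List.Membership.Propositional using (_∈_; find; lose)
open import Data.List.Membership.Propositional.Properties using (∈-tabulate⁺)
open import Data.Vec.Functional using (insertAt)
open import Data.Vec.Functional.Properties using (insertAt-lookup; insertAt-punchIn; insertAt-removeAt)
import Data.Vec.Functional.Relation.Binary.Pointwise.Properties as Pointwise
import Data.Vec.Functional.Relation.Binary.Equality.Setoid as VecEquality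
open import Relation.Nullary using (¬_; Dec; yes; no)
open import Relation.Nullary.Decidable using (map′; _×-dec_; _⊎-dec_; ¬?)
open import Relation.Unary using (Pred)
open import Relation.Binary using (Rel; Setoid; IsDecEquivalence; Decidable)
import Relation.Binary.Construct.On as On
open import Relation.Binary.PropositionalEquality using (_≡_; _≢_; refl; cong; subst; module ≡-Reasoning)
import Relation.Binary.PropositionalEquality as ≡
open import Relation.Binary.Construct.Closure.ReflexiveTransitive using (Star; ε; _◅_; _◅◅_)
open import Algebra.Bundles using (CommutativeRing)
open import Algebra.Properties.CommutativeSemigroup ℕ.*-commutativeSemigroup using (interchange)

private
  variable
    a b ℓ ℓ₁ ℓ₂ p p₁ p₂ : Level
    A B : Set a
    N M : ℕ

record Enumeration {A : Set a} (_≈_ : Rel A ℓ) (P : Pred A p) (N : ℕ) : Set (a ⊔ ℓ ⊔ p) where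
  field
    elem            : Fin N → A
    elem-∈          : ∀ k → P (elem k)
    elem-injective  : ∀ {k k'} → elem k ≈ elem k' → k ≡ k'
    elem-surjective : ∀ {x} → P x → ∃[ k ] elem k ≈ x

module _ {_≈_ : Rel A ℓ} {P : Pred A p} where

  Enumeration-size≡suc : ∀ {x} → Enumeration _≈_ P N → P x → N ≡ suc (N ∸ 1)
  Enumeration-size≡suc {N = zero} E px with () ← proj₁ (Enumeration.elem-surjective E px)
  Enumeration-size≡suc {N = suc N} _ _ = refl

  Enumeration-⇔ : {Q : Pred A p₁} → (∀ {x} → P x → Q x) → (∀ {x} → Q x → P x) →
                  Enumeration _≈_ P N → Enumeration _≈_ Q N
  Enumeration-⇔ P⇒Q Q⇒P E = record
    { elem            = elem
    ; elem-∈          = P⇒Q ∘ elem-∈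
    ; elem-injective  = elem-injective
    ; elem-surjective = elem-surjective ∘ Q⇒P
    }
    where open Enumeration E

  Enumeration-Σ : {D : Pred A p₁} → (∀ {x} → P x → D x) →
                  Enumeration _≈_ P N → Enumeration {A = Σ A D} (_≈_ on proj₁) (P ∘ proj₁) N
  Enumeration-Σ P⇒D E = record
    { elem            = λ k → elem k , P⇒D (elem-∈ k)
    ; elem-∈          = elem-∈
    ; elem-injective  = elem-injective
    ; elem-surjective = elem-surjective
    }
    where open Enumeration E

Enumeration-× : {_≈₁_ : Rel A ℓ₁} {_≈₂_ : Rel B ℓ₂} {P : Pred A p₁} {Q : Pred B p₂} →
                Enumeration _≈₁_ P N → Enumeration _≈₂_ Q M →
                Enumeration (Pointwise _≈₁_ _≈₂_) (λ xy → P (proj₁ xy) × Q (proj₂ xy)) (N * M)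
Enumeration-× {A = A} {B = B} {N = N} {M = M} {_≈₁_ = _≈₁_} {_≈₂_ = _≈₂_} {P = P} {Q = Q} E₁ E₂ = record
  { elem            = elem
  ; elem-∈          = λ k → E₁.elem-∈ _ , E₂.elem-∈ _
  ; elem-injective  = injective
  ; elem-surjective = surjective
  }
  where
  module E₁ = Enumeration E₁
  module E₂ = Enumeration E₂

  elemPair : Fin N × Fin M → A × B
  elemPair (i , j) = E₁.elem i , E₂.elem j

  split : Fin (N * M) → Fin N × Fin M
  split = remQuot {N} M

  elem : Fin (N * M) → A × B
  elem = elemPair ∘ split

  injective : ∀ {k k'} → Pointwise _≈₁_ _≈₂_ (elem k) (elem k') → k ≡ k'
  injective {k} {k'} (≈₁ , ≈₂) = begin
    k                                             ≡⟨ Fin.combine-remQuot {N} M k ⟨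
    combine (proj₁ (split k)) (proj₂ (split k))   ≡⟨ ≡.cong₂ combine (E₁.elem-injective ≈₁) (E₂.elem-injective ≈₂) ⟩
    combine (proj₁ (split k')) (proj₂ (split k')) ≡⟨ Fin.combine-remQuot {N} M k' ⟩
    k'                                            ∎
    where open ≡-Reasoning

  surjective : ∀ {xy} → P (proj₁ xy) × Q (proj₂ xy) → ∃[ k ] Pointwise _≈₁_ _≈₂_ (elem k) xy
  surjective {xy} (px , qy) with i , ≈₁ ← E₁.elem-surjective px | j , ≈₂ ← E₂.elem-surjective qy =
    combine i j ,
    subst (λ ij → Pointwise _≈₁_ _≈₂_ (elemPair ij) xy) (≡.sym (Fin.remQuot-combine {N} {M} i j)) (≈₁ , ≈₂)

module _ (S : Setoid a ℓ) where
  open Setoid S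
  open VecEquality S using (_≋_)

  Enumeration-decidable : {P : Pred Carrier p} → Enumeration _≈_ P N →
                          ∀ {x y} → P x → P y → Dec (x ≈ y)
  Enumeration-decidable E px py
    with i , i≈x ← Enumeration.elem-surjective E px | j , j≈y ← Enumeration.elem-surjective E py =
    map′ (λ i≡j → trans (sym i≈x) (trans (reflexive (cong elem i≡j)) j≈y))
         (λ x≈y → elem-injective (trans i≈x (trans x≈y (sym j≈y))))
         (i Fin.≟ j)
    where open Enumeration E

  Enumeration-remove : {P : Pred Carrier p} → Enumeration _≈_ P (suc N) →
                       ∀ {z} → P z → Enumeration _≈_ (λ x → P x × ¬ x ≈ z) N
  Enumeration-remove {P = P} E {z} pz = record
    { elem            = elem ∘ punchIn k₀
    ; elem-∈          = λ t → elem-∈ _ , λ e → Fin.punchInᵢ≢i k₀ t (elem-injective (trans e (sym k₀≈z)))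
    ; elem-injective  = Fin.punchIn-injective k₀ _ _ ∘ elem-injective
    ; elem-surjective = surjective
    }
    where
    open Enumeration E
    k₀ = proj₁ (elem-surjective pz)
    k₀≈z = proj₂ (elem-surjective pz)

    surjective : ∀ {x} → P x × ¬ x ≈ z → ∃[ t ] elem (punchIn k₀ t) ≈ x
    surjective (px , x≉z) with k , k≈x ← elem-surjective px =
      punchOut k₀≢k , trans (reflexive (cong elem (Fin.punchIn-punchOut k₀≢k))) k≈x
      where
      k₀≢k : k₀ ≢ k
      k₀≢k refl = x≉z (trans (sym k≈x) k₀≈z)

  insertAt-cong : ∀ {m} (i : Fin (suc m)) {x y} {u v} → x ≈ y → u ≋ v → insertAt u i x ≋ insertAt v i y
  insertAt-cong zero x≈y u≋v zero = x≈y
  insertAt-cong zero x≈y u≋v (suc k) = u≋v k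
  insertAt-cong {suc m} (suc i) x≈y u≋v zero = u≋v zero
  insertAt-cong {suc m} (suc i) x≈y u≋v (suc k) = insertAt-cong i x≈y (u≋v ∘ suc) k

  Enumeration-insertAt : ∀ {m} (i : Fin (suc m)) {P : Pred Carrier p₁} {Q : Pred Carrier p₂} →
                         Enumeration _≈_ P N → Enumeration (_≋_ {m}) (λ v → ∀ k → Q (v k)) M →
                         Enumeration (_≋_ {suc m}) (λ v → P (v i) × ∀ k → Q (v (punchIn i k))) (N * M)
  Enumeration-insertAt {m = m} i {P} {Q} E₁ E₂ = record
    { elem            = insert ∘ elem
    ; elem-∈          = λ k → insert-∈ (elem-∈ k)
    ; elem-injective  = elem-injective ∘ insert-injective
    ; elem-surjective = surjective
    }
    where
    open Enumeration (Enumeration-× E₁ E₂)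
    open VecEquality S using (≋-trans)

    insert : Carrier × (Fin m → Carrier) → Fin (suc m) → Carrier
    insert (x , v) = insertAt v i x

    insert-∈ : ∀ {x v} → P x × (∀ k → Q (v k)) → P (insert (x , v) i) × ∀ k → Q (insert (x , v) (punchIn i k))
    insert-∈ {x} {v} (px , qv) =
      subst P (≡.sym (insertAt-lookup v i x)) px ,
      λ k → subst Q (≡.sym (insertAt-punchIn v i x k)) (qv k)

    insert-injective : ∀ {xv yw} → insert xv ≋ insert yw → Pointwise _≈_ _≋_ xv yw
    insert-injective {x , v} {y , w} e =
      trans (reflexive (≡.sym (insertAt-lookup v i x))) (trans (e i) (reflexive (insertAt-lookup w i y))) ,
      λ k → trans (reflexive (≡.sym (insertAt-punchIn v i x k)))
                  (trans (e (punchIn i k)) (reflexive (insertAt-punchIn w i y k)))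

    surjective : ∀ {v} → P (v i) × (∀ k → Q (v (punchIn i k))) → ∃[ k ] insert (elem k) ≋ v
    surjective {v} pq with k , (≈₁ , ≈₂) ← elem-surjective pq =
      k , ≋-trans (insertAt-cong i ≈₁ ≈₂) (reflexive ∘ insertAt-removeAt v i)

  Enumeration-vector : {Q : Pred Carrier p} → Enumeration _≈_ Q N →
                       ∀ m → Enumeration (_≋_ {m}) (λ v → ∀ k → Q (v k)) (N ^ m)
  Enumeration-vector _ zero = record
    { elem            = λ _ ()
    ; elem-∈          = λ _ ()
    ; elem-injective  = λ { {zero} {zero} _ → ≡.refl }
    ; elem-surjective = λ _ → zero , λ ()
    }
  Enumeration-vector {Q = Q} E (suc m) =
    Enumeration-⇔ {Q = λ v → ∀ k → Q (v k)}
      (λ (q₀ , qs) → λ { zero → q₀ ; (suc k) → qs k }) (λ qs → qs zero , qs ∘ suc)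
      (Enumeration-insertAt zero {Q = Q} E (Enumeration-vector E m))

module _ {v e} (G : Graph v e) (isDecEquivalence : IsDecEquivalence (Graph._≈V_ G)) where
  open Graph G
  open IsDecEquivalence isDecEquivalence using (_≟_) renaming (refl to ≈-refl; sym to ≈-sym; trans to ≈-trans)

  Edges : Set v
  Edges = List (Vertex × Vertex)

  Joins : Vertex → Vertex → Vertex × Vertex → Set e
  Joins x y p = (proj₁ p ≈V x × proj₂ p ≈V y) ⊎ (proj₁ p ≈V y × proj₂ p ≈V x)

  joins-unique : ∀ {x y x' y' p} → Joins x y p → Joins x' y' p →
                 (x ≈V x' × y ≈V y') ⊎ (x ≈V y' × y ≈V x')
  joins-unique (inj₁ (p₁≈x , p₂≈y)) (inj₁ (p₁≈x' , p₂≈y')) = inj₁ (≈-trans (≈-sym p₁≈x) p₁≈x' , ≈-trans (≈-sym p₂≈y) p₂≈y')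
  joins-unique (inj₁ (p₁≈x , p₂≈y)) (inj₂ (p₁≈y' , p₂≈x')) = inj₂ (≈-trans (≈-sym p₁≈x) p₁≈y' , ≈-trans (≈-sym p₂≈y) p₂≈x')
  joins-unique (inj₂ (p₁≈y , p₂≈x)) (inj₁ (p₁≈x' , p₂≈y')) = inj₂ (≈-trans (≈-sym p₂≈x) p₂≈y' , ≈-trans (≈-sym p₁≈y) p₁≈x')
  joins-unique (inj₂ (p₁≈y , p₂≈x)) (inj₂ (p₁≈y' , p₂≈x')) = inj₁ (≈-trans (≈-sym p₂≈x) p₂≈x' , ≈-trans (≈-sym p₁≈y) p₁≈y')

  joins? : ∀ x y p → Dec (Joins x y p)
  joins? x y p = ((proj₁ p ≟ x) ×-dec (proj₂ p ≟ y)) ⊎-dec ((proj₁ p ≟ y) ×-dec (proj₂ p ≟ x))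

  edgeIn? : ∀ F x y → Dec (EdgeIn G F x y)
  edgeIn? F x y = map′ find (λ (_ , p∈F , joins) → lose p∈F joins) (any? (joins? x y) F)

  edgeIn-respˡ : ∀ {F x x' y} → x ≈V x' → EdgeIn G F x y → EdgeIn G F x' y
  edgeIn-respˡ x≈x' (p , p∈F , inj₁ (p₁≈x , p₂≈y)) = p , p∈F , inj₁ (≈-trans p₁≈x x≈x' , p₂≈y)
  edgeIn-respˡ x≈x' (p , p∈F , inj₂ (p₁≈y , p₂≈x)) = p , p∈F , inj₂ (p₁≈y , ≈-trans p₂≈x x≈x')

  Reachable : Edges → Vertex → Vertex → Set (v ⊔ e)
  Reachable F x y = ∃[ z ] (Star (AdjMinus G F) x z × z ≈V y)

  ¬edgeConnected-suc-degree : ∀ {x d} → Enumeration _≈V_ (Adj x) d → ¬ EdgeConnected G (suc d)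
  ¬edgeConnected-suc-degree {x} {d} neighbours ((y , z , y≉z) , connected) =
    isolated (connected F F-short x w)
    where
    open Enumeration neighbours

    F : Edges
    F = tabulate (λ k → x , elem k)

    F-short : length F < suc d
    F-short = s≤s (ℕ.≤-reflexive (length-tabulate _))

    edgeIn-F : ∀ {w} → Adj x w → EdgeIn G F x w
    edgeIn-F adj with k , k≈w ← elem-surjective adj = (x , elem k) , ∈-tabulate⁺ k , inj₁ (≈-refl , k≈w)

    another : ∃[ w ] ¬ w ≈V x
    another with y ≟ x
    ... | yes y≈x = z , λ z≈x → y≉z (≈-trans y≈x (≈-sym z≈x))
    ... | no y≉x = y , y≉x

    w = proj₁ another
    w≉x = proj₂ another

    isolated : ¬ Reachable F x w
    isolated (_ , ε , x≈w) = w≉x (≈-sym x≈w)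
    isolated (_ , (adj , ∉F) ◅ _ , _) = ∉F (edgeIn-F adj)

  module _ {P : Pred Vertex p} {N} (E : Enumeration _≈V_ P N)
           (clique : ∀ {x y} → P x → P y → ¬ x ≈V y → Adj x y)
           (F : Edges) (F-short : 2 + length F ≤ N) where
    open Enumeration E

    private
      Free : Vertex → Vertex → Fin N → Set (v ⊔ e)
      Free x y k = ¬ elem k ≈V x × ¬ elem k ≈V y × ¬ EdgeIn G F x (elem k) × ¬ EdgeIn G F (elem k) y

      free? : ∀ x y k → Dec (Free x y k)
      free? x y k = ¬? (elem k ≟ x) ×-dec ¬? (elem k ≟ y) ×-dec
                    ¬? (edgeIn? F x (elem k)) ×-dec ¬? (edgeIn? F (elem k) y)

      Blocking : Vertex → Vertex → Fin N → Vertex × Vertex → Set e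
      Blocking x y k p = Joins x (elem k) p ⊎ Joins (elem k) y p

      -- A vertex that is not free is a copy of y or meets an edge of F towards x or y (a copy of x
      -- meets the edge xy).  Each edge blocks at most one vertex, so with y that gives at most
      -- 1 + length F < N blocked vertices.
      Blocked : Vertex → Vertex → Fin N → Set (v ⊔ e)
      Blocked x y k = elem k ≈V y ⊎ (¬ elem k ≈V y × ∃[ p ] (p ∈ F × Blocking x y k p))

      slot : ∀ {x y k} → Blocked x y k → Fin (suc (length F))
      slot (inj₁ _) = fromℕ _
      slot (inj₂ (_ , _ , p∈F , _)) = inject₁ (index p∈F)

      blocked : ∀ {x y} → EdgeIn G F x y → ∀ k → ¬ Free x y k → Blocked x y k
      blocked {x} {y} xy∈F k ¬free with elem k ≟ y
      ... | yes k≈y = inj₁ k≈y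
      ... | no k≉y with edgeIn? F x (elem k) | edgeIn? F (elem k) y | elem k ≟ x
      ...   | yes (p , p∈F , joins) | _ | _ = inj₂ (k≉y , p , p∈F , inj₁ joins)
      ...   | no _ | yes (p , p∈F , joins) | _ = inj₂ (k≉y , p , p∈F , inj₂ joins)
      ...   | no _ | no _ | yes k≈x with p , p∈F , joins ← edgeIn-respˡ (≈-sym k≈x) xy∈F =
        inj₂ (k≉y , p , p∈F , inj₂ joins)
      ...   | no ∉₁ | no ∉₂ | no k≉x = ⊥-elim (¬free (k≉x , k≉y , ∉₁ , ∉₂))

      blocking-unique : ∀ {x y k k' p} → ¬ elem k ≈V y → ¬ elem k' ≈V y →
                        Blocking x y k p → Blocking x y k' p → elem k ≈V elem k'
      blocking-unique _ _ (inj₁ j) (inj₁ j') with joins-unique j j'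
      ... | inj₁ (_ , k≈k') = k≈k'
      ... | inj₂ (x≈k' , k≈x) = ≈-trans k≈x x≈k'
      blocking-unique k≉y _ (inj₂ j) (inj₂ j') with joins-unique j j'
      ... | inj₁ (k≈k' , _) = k≈k'
      ... | inj₂ (k≈y , _) = ⊥-elim (k≉y k≈y)
      blocking-unique k≉y _ (inj₁ j) (inj₂ j') with joins-unique j j'
      ... | inj₁ (_ , k≈y) = ⊥-elim (k≉y k≈y)
      ... | inj₂ (_ , k≈k') = k≈k'
      blocking-unique _ k'≉y (inj₂ j) (inj₁ j') with joins-unique j j'
      ... | inj₁ (_ , y≈k') = ⊥-elim (k'≉y (≈-sym y≈k'))
      ... | inj₂ (k≈k' , _) = k≈k'

      slot-injective : ∀ {x y k k'} (b : Blocked x y k) (b' : Blocked x y k') →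
                       slot b ≡ slot b' → elem k ≈V elem k'
      slot-injective (inj₁ k≈y) (inj₁ k'≈y) _ = ≈-trans k≈y (≈-sym k'≈y)
      slot-injective (inj₁ _) (inj₂ _) eq = ⊥-elim (Fin.fromℕ≢inject₁ eq)
      slot-injective (inj₂ _) (inj₁ _) eq = ⊥-elim (Fin.fromℕ≢inject₁ (≡.sym eq))
      slot-injective (inj₂ (k≉y , p , p∈F , b)) (inj₂ (k'≉y , p' , p'∈F , b')) eq =
        blocking-unique k≉y k'≉y b (subst (Blocking _ _ _) (≡.sym same-edge) b')
        where
        same-edge : p ≡ p'
        same-edge = ≡.trans (lookup-index p∈F)
                      (≡.trans (cong (lookup F) (Fin.inject₁-injective eq)) (≡.sym (lookup-index p'∈F)))

      not-all-blocked : ∀ {x y} → EdgeIn G F x y → ¬ (∀ k → ¬ Free x y k)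
      not-all-blocked xy∈F none
        with i , j , i<j , eq ← Fin.pigeonhole F-short (λ k → slot (blocked xy∈F k (none k))) =
        Fin.<⇒≢ i<j (elem-injective (slot-injective (blocked xy∈F i (none i)) (blocked xy∈F j (none j)) eq))

      free-vertex : ∀ {x y} → EdgeIn G F x y → ∃ (Free x y)
      free-vertex {x} {y} xy∈F with Fin.any? (free? x y)
      ... | yes found = found
      ... | no none = ⊥-elim (not-all-blocked xy∈F (λ k free → none (k , free)))

      detour : ∀ {x y k} → P x → P y → Free x y k → Star (AdjMinus G F) x y
      detour {k = k} px py (k≉x , k≉y , ∉₁ , ∉₂) =
        (clique px (elem-∈ k) (k≉x ∘ ≈-sym) , ∉₁) ◅ (clique (elem-∈ k) py k≉y , ∉₂) ◅ ε

    reachable-in-clique : ∀ {x y} → P x → P y → Reachable F x y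
    reachable-in-clique {x} {y} px py with x ≟ y
    ... | yes x≈y = x , ε , x≈y
    ... | no x≉y with edgeIn? F x y
    ...   | no xy∉F = y , (clique px py x≉y , xy∉F) ◅ ε , ≈-refl
    ...   | yes xy∈F = y , detour px py (proj₂ (free-vertex xy∈F)) , ≈-refl

  record CliqueCover {ι c} (N : ℕ) : Set (v ⊔ e ⊔ lsuc (ι ⊔ c)) where
    field
      Index            : Set ι
      Cell             : Index → Pred Vertex c
      cell-enumeration : ∀ i → Enumeration _≈V_ (Cell i) N
      cell-clique      : ∀ i {x y} → Cell i x → Cell i y → ¬ x ≈V y → Adj x y
      cell-resp        : ∀ i {x y} → x ≈V y → Cell i x → Cell i y
      covering         : ∀ x → ∃[ i ] Cell i x
      overlapping      : ∀ i j → ∃[ z ] (Cell i z × Cell j z)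

  cliqueCover⇒edgeConnected : ∀ {ι c N} → CliqueCover {ι} {c} (2 + N) → Vertex → EdgeConnected G (suc N)
  cliqueCover⇒edgeConnected cover x₀ = two-vertices , connected
    where
    open CliqueCover cover
    open Enumeration (cell-enumeration (proj₁ (covering x₀)))

    two-vertices : ∃[ x ] ∃[ y ] ¬ x ≈V y
    two-vertices = elem zero , elem (suc zero) , Fin.0≢1+n ∘ elem-injective

    connected : ∀ F → length F < _ → ConnectedMinus G F
    connected F (s≤s F-short) x y
      with i , x∈i ← covering x | j , y∈j ← covering y
      with z , z∈i , z∈j ← overlapping i j
      with z' , x→z' , z'≈z ← reachable-in-clique (cell-enumeration i) (cell-clique i) F (s≤s (s≤s F-short)) x∈i z∈i
      with w , z'→w , w≈y ← reachable-in-clique (cell-enumeration j) (cell-clique j) F (s≤s (s≤s F-short))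
                             (cell-resp j (≈-sym z'≈z) z∈j) y∈j
      = w , x→z' ◅◅ z'→w , w≈y

  cliqueCover⇒edgeConnectivity : ∀ {ι c N x₀} → CliqueCover {ι} {c} (suc N) →
                                 Enumeration _≈V_ (Adj x₀) N → IsEdgeConnectivity G N
  cliqueCover⇒edgeConnectivity {N = zero} _ neighbours = inj₂ refl , ¬edgeConnected-suc-degree neighbours
  cliqueCover⇒edgeConnectivity {N = suc N} {x₀} cover neighbours =
    inj₁ (cliqueCover⇒edgeConnected cover x₀) , ¬edgeConnected-suc-degree neighbours

-- The field has suc q elements, q of them nonzero; the summands have dimensions suc r and suc s.
module DirectSum {c ℓ} (R : CommutativeRing c ℓ) (isField : IsField R) {q} (card : HasCard R (suc q)) (r s : ℕ) where
  open CommutativeRing R using (Carrier; _≈_; 0#; 1#; setoid; isEquivalence)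
    renaming (refl to ≈-refl; sym to ≈-sym; trans to ≈-trans)
  open IsField isField using (0≉1)
  open HasCard card using (enum; surj; injective)
  open VecEquality setoid using (_≋_)

  1≉0 : ¬ 1# ≈ 0#
  1≉0 = 0≉1 ∘ ≈-sym

  carrierEnumeration : Enumeration _≈_ (λ _ → ⊤) (suc q)
  carrierEnumeration = record
    { elem            = enum
    ; elem-∈          = λ _ → tt
    ; elem-injective  = injective _ _
    ; elem-surjective = λ {x} _ → surj x
    }

  _≟_ : Decidable _≈_
  x ≟ y = Enumeration-decidable setoid carrierEnumeration tt tt

  nonzeroAt-enumeration : ∀ {m} (i : Fin (suc m)) → Enumeration (_≋_ {suc m}) (λ a → ¬ a i ≈ 0#) (q * suc q ^ m)
  nonzeroAt-enumeration {m} i =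
    Enumeration-⇔ (proj₂ ∘ proj₁) (λ a≉0 → (tt , a≉0) , λ _ → tt)
      (Enumeration-insertAt setoid i (Enumeration-remove setoid carrierEnumeration tt)
                                     (Enumeration-vector setoid carrierEnumeration m))

  G : Graph (c ⊔ ℓ) ℓ
  G = DirectSumGraph R (suc r) (suc s)

  open Graph G using (Vertex; Adj; _≈V_)

  ≈V-isDecEquivalence : IsDecEquivalence _≈V_
  ≈V-isDecEquivalence = On.isDecEquivalence proj₁ (×-isDecEquivalence vectors vectors)
    where
    vectors : ∀ {m} → IsDecEquivalence (_≋_ {m})
    vectors = Pointwise.isDecEquivalence (record { isEquivalence = isEquivalence ; _≟_ = _≟_ }) _

  open IsDecEquivalence ≈V-isDecEquivalence using () renaming (sym to ≈V-sym)

  vertexSetoid : Setoid (c ⊔ ℓ) ℓ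
  vertexSetoid = record { isEquivalence = IsDecEquivalence.isEquivalence ≈V-isDecEquivalence }

  InCell : Fin (suc r) → Fin (suc s) → Pred Vertex ℓ
  InCell i j x = ¬ coefU R x i ≈ 0# × ¬ coefW R x j ≈ 0#

  cellSize : ℕ
  cellSize = (q * suc q ^ r) * (q * suc q ^ s)

  cell-enumeration : ∀ i j → Enumeration _≈V_ (InCell i j) cellSize
  cell-enumeration i j =
    Enumeration-Σ (λ (a≉0 , b≉0) → (λ a≈0 → a≉0 (a≈0 i)) , (λ b≈0 → b≉0 (b≈0 j)))
      (Enumeration-× (nonzeroAt-enumeration i) (nonzeroAt-enumeration j))

  pick-nonzero : ∀ {m} (a : Fin m → Carrier) → ¬ (∀ i → a i ≈ 0#) → ∃[ i ] ¬ a i ≈ 0#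
  pick-nonzero {m} a = Fin.¬∀⟶∃¬ m _ (λ i → a i ≟ 0#)

  ones : Vertex
  ones = ((λ _ → 1#) , (λ _ → 1#)) , (λ h → 1≉0 (h zero)) , (λ h → 1≉0 (h zero))

  cover : CliqueCover G ≈V-isDecEquivalence {Level.zero} {ℓ} cellSize
  cover = record
    { Index            = Fin (suc r) × Fin (suc s)
    ; Cell             = λ (i , j) → InCell i j
    ; cell-enumeration = λ (i , j) → cell-enumeration i j
    ; cell-clique      = λ (i , j) (a₁ , b₁) (a₂ , b₂) x≉y → x≉y , (i , a₁ , a₂) , (j , b₁ , b₂)
    ; cell-resp        = λ (i , j) (a≈ , b≈) (a≉0 , b≉0) → a≉0 ∘ ≈-trans (a≈ i) , b≉0 ∘ ≈-trans (b≈ j)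
    ; covering         = λ ((a , b) , a≉0 , b≉0) →
                           let i , ai≉0 = pick-nonzero a a≉0 ; j , bj≉0 = pick-nonzero b b≉0
                           in (i , j) , ai≉0 , bj≉0
    ; overlapping      = λ _ _ → ones , (1≉0 , 1≉0) , (1≉0 , 1≉0)
    }

  δ₀ : ∀ {m} → Fin (suc m) → Carrier
  δ₀ zero = 1#
  δ₀ (suc _) = 0#

  x₀ : Vertex
  x₀ = (δ₀ , δ₀) , (λ h → 1≉0 (h zero)) , (λ h → 1≉0 (h zero))

  x₀∈cell : InCell zero zero x₀
  x₀∈cell = 1≉0 , 1≉0

  δ₀-support : ∀ {m} (i : Fin (suc m)) → ¬ δ₀ i ≈ 0# → i ≡ zero
  δ₀-support zero _ = refl
  δ₀-support (suc _) δi≉0 = ⊥-elim (δi≉0 ≈-refl)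

  adj-x₀⇒cell : ∀ {w} → Adj x₀ w → InCell zero zero w × ¬ w ≈V x₀
  adj-x₀⇒cell {w} (x₀≉w , (i , δi≉0 , wi≉0) , (j , δj≉0 , wj≉0)) =
    ( subst (λ i → ¬ coefU R w i ≈ 0#) (δ₀-support i δi≉0) wi≉0
    , subst (λ j → ¬ coefW R w j ≈ 0#) (δ₀-support j δj≉0) wj≉0 ) ,
    λ w≈x₀ → x₀≉w (≈V-sym {w} {x₀} w≈x₀)

  cell⇒adj-x₀ : ∀ {w} → InCell zero zero w × ¬ w ≈V x₀ → Adj x₀ w
  cell⇒adj-x₀ {w} ((a≉0 , b≉0) , w≉x₀) =
    (λ x₀≈w → w≉x₀ (≈V-sym {x₀} {w} x₀≈w)) , (zero , 1≉0 , a≉0) , (zero , 1≉0 , b≉0)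

  cellSize≡suc : cellSize ≡ suc (cellSize ∸ 1)
  cellSize≡suc = Enumeration-size≡suc {x = x₀} (cell-enumeration zero zero) x₀∈cell

  x₀-neighbours : Enumeration _≈V_ (Adj x₀) (cellSize ∸ 1)
  x₀-neighbours =
    Enumeration-⇔ {P = λ w → InCell zero zero w × ¬ w ≈V x₀} (λ {w} → cell⇒adj-x₀ {w}) (λ {w} → adj-x₀⇒cell {w})
      (Enumeration-remove vertexSetoid
        (subst (Enumeration _≈V_ (InCell zero zero)) cellSize≡suc (cell-enumeration zero zero)) {x₀} x₀∈cell)

  edgeConnectivity : IsEdgeConnectivity G (cellSize ∸ 1)
  edgeConnectivity =
    cliqueCover⇒edgeConnectivity G ≈V-isDecEquivalence {x₀ = x₀}
      (subst (CliqueCover G ≈V-isDecEquivalence) cellSize≡suc cover) x₀-neighbours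

*-^-interchange : ∀ a b m n → (a * b ^ m) * (a * b ^ n) ≡ a * a * b ^ (m + n)
*-^-interchange a b m n = ≡.trans (interchange a (b ^ m) a (b ^ n)) (cong (a * a *_) (≡.sym (ℕ.^-distribˡ-+-* b m n)))

corollary3p2 : ∀ {c ℓ : Level} (F : CommutativeRing c ℓ) → IsField F →
    (q : ℕ) → HasCard F q →
    (n r s : ℕ) → 2 ≤ n → 1 ≤ r → 1 ≤ s → r + s ≡ n →
    IsEdgeConnectivity (DirectSumGraph F r s) ((q ∸ 1) * (q ∸ 1) * q ^ (n ∸ 2) ∸ 1)
corollary3p2 F _ zero card _ _ _ _ _ _ _ with () ← proj₁ (HasCard.surj card (CommutativeRing.0# F))
corollary3p2 F isField (suc q) card _ (suc r) (suc s) _ (s≤s z≤n) (s≤s z≤n) refl =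
  subst (λ k → IsEdgeConnectivity (DirectSumGraph F (suc r) (suc s)) (k ∸ 1)) cellSize≡
    (DirectSum.edgeConnectivity F isField card r s)
  where
  cellSize≡ : (q * suc q ^ r) * (q * suc q ^ s) ≡ q * q * suc q ^ (suc r + suc s ∸ 2)
  cellSize≡ = ≡.trans (*-^-interchange q (suc q) r s) (cong (λ k → q * q * suc q ^ k) (≡.sym (cong (_∸ 1) (ℕ.+-suc r s))))
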